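{- Let $\varepsilon>0$ and let $G=K^c_{n,n}$ be an edge-colored complete balanced bipartite graph with bipartition $(X,Y)$ and $\delta^c(G)\geq(\frac{2}{3}+\varepsilon)n$. Suppose $n\geq \frac{4}{\varepsilon}$. Then (i) $|\mathcal{P}(x,y)|\geq \frac{16}{9}\varepsilon^2 n^4$ for every $x\in X$, $y\in Y$; and (ii) $|\mathcal{P}(x_1,y_1;x_2,y_2)|\geq \frac{16}{9}\varepsilon^2 n^4$ for all distinct $x_1,x_2\in X$ and distinct $y_1,y_2\in Y$.
   Context: A subgraph is properly colored (PC) if every two adjacent edges have distinct colors; color degree of a vertex is the number of distinct colors on its incident edges, and $\delta^c$ is the minimum color degree. For $x\in X,y\in Y$, an absorbing path for $(x,y)$ is a path $P=x'y'x''y''$ (with $x',x''\in X$, $y',y''\in Y$) such that $P$ is a PC path with 3 edges, $V(P)\cap\{x,y\}=\emptyset$, and the path $x'y'xyx''y''$ is properly colored; $\mathcal{P}(x,y)$ is the set of such paths. For four distinct vertices $x_1,x_2\in X$, $y_1,y_2\in Y$, an absorbing path for $(x_1,y_1;x_2,y_2)$ is a path $P=x'y'x''y''$ such that $P$ is a PC path with 3 edges, $V(P)\cap\{x_1,y_1,x_2,y_2\}=\emptyset$, and the two paths $x'y'x_1y_1$ and $y''x''y_2x_2$ are properly colored; $\mathcal{P}(x_1,y_1;x_2,y_2)$ is the set of such paths.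
   Formalization: The parameter ε ranges over the positive rationals. -}

module Defs where

open import Data.Nat as ℕ using (ℕ)
open import Data.Fin using (Fin)
open import Data.Fin.Properties using () renaming (_≟_ to _≟ᶠ_)
open import Data.List using (List; length; map; filter; deduplicate; concatMap; [_])
open import Data.List using () renaming (allFin to allFinL)
open import Data.Product using (_×_; _,_)
open import Relation.Nullary using (¬_; Dec)
open import Relation.Nullary.Decidable using (_×-dec_; ¬?)
open import Relation.Binary.PropositionalEquality using (_≡_; _≢_)
open import Data.Rational using (ℚ; 0ℚ; _<_; _÷_; Positive; positive; _/_)
open import Data.Integer using (+_)
open import Data.Rational.Properties using (pos⇒nonZero)

-- An edge-colouring of the complete balanced bipartite graph K_{n,n} with
-- parts X = Fin n and Y = Fin n: the edge xy (x ∈ X, y ∈ Y) gets colour c x y.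
Colouring : ℕ → Set
Colouring n = Fin n → Fin n → ℕ

colDegX : ∀ {n} → Colouring n → Fin n → ℕ
colDegX {n} c x = length (deduplicate ℕ._≟_ (map (λ y → c x y) (allFinL n)))

colDegY : ∀ {n} → Colouring n → Fin n → ℕ
colDegY {n} c y = length (deduplicate ℕ._≟_ (map (λ x → c x y) (allFinL n)))

MinColDegAtLeast : ∀ {n} → Colouring n → (ℕ → Set) → Set
MinColDegAtLeast {n} c P = (∀ x → P (colDegX c x)) × (∀ y → P (colDegY c y))

-- candidate paths x' y' x'' y'' as quadruples (x' , y' , x'' , y'')
Quad : ℕ → Set
Quad n = Fin n × Fin n × Fin n × Fin n

allQuads : (n : ℕ) → List (Quad n)
allQuads n =
  concatMap (λ a → concatMap (λ b → concatMap (λ c → map (λ d → (a , b , c , d))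
    (allFinL n)) (allFinL n)) (allFinL n)) (allFinL n)


IsPCPath3 : ∀ {n} → Colouring n → Quad n → Set
IsPCPath3 c (x' , y' , x'' , y'') =
  x' ≢ x'' × y' ≢ y'' × c x' y' ≢ c x'' y' × c x'' y' ≢ c x'' y''

AbsPath : ∀ {n} → Colouring n → Fin n → Fin n → Quad n → Set
AbsPath c x y P@(x' , y' , x'' , y'') =
  IsPCPath3 c P ×
  (x' ≢ x × x'' ≢ x × y' ≢ y × y'' ≢ y) ×
  -- x'y'xyx''y'' is properly coloured
  (c x' y' ≢ c x y' × c x y' ≢ c x y × c x y ≢ c x'' y × c x'' y ≢ c x'' y'')

AbsPath2 : ∀ {n} → Colouring n → Fin n → Fin n → Fin n → Fin n → Quad n → Set
AbsPath2 c x₁ y₁ x₂ y₂ P@(x' , y' , x'' , y'') =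
  IsPCPath3 c P ×
  (x' ≢ x₁ × x'' ≢ x₁ × x' ≢ x₂ × x'' ≢ x₂ ×
   y' ≢ y₁ × y'' ≢ y₁ × y' ≢ y₂ × y'' ≢ y₂) ×
  -- x'y'x₁y₁ is properly coloured
  (c x' y' ≢ c x₁ y' × c x₁ y' ≢ c x₁ y₁) ×
  -- y''x''y₂x₂ is properly coloured
  (c x'' y'' ≢ c x'' y₂ × c x'' y₂ ≢ c x₂ y₂)

private
  _≠?_ : ∀ {A : Set} → (∀ (a b : A) → Dec (a ≡ b)) → ∀ a b → Dec (a ≢ b)
  (eq ≠? a) b = ¬? (eq a b)

isPCPath3? : ∀ {n} (c : Colouring n) (P : Quad n) → Dec (IsPCPath3 c P)
isPCPath3? c (x' , y' , x'' , y'') =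
  (_≟ᶠ_ ≠? x') x'' ×-dec (_≟ᶠ_ ≠? y') y'' ×-dec
  (ℕ._≟_ ≠? c x' y') (c x'' y') ×-dec (ℕ._≟_ ≠? c x'' y') (c x'' y'')

absPath? : ∀ {n} (c : Colouring n) x y (P : Quad n) → Dec (AbsPath c x y P)
absPath? c x y P@(x' , y' , x'' , y'') =
  isPCPath3? c P ×-dec
  ((_≟ᶠ_ ≠? x') x ×-dec (_≟ᶠ_ ≠? x'') x ×-dec (_≟ᶠ_ ≠? y') y ×-dec (_≟ᶠ_ ≠? y'') y) ×-dec
  ((ℕ._≟_ ≠? c x' y') (c x y') ×-dec (ℕ._≟_ ≠? c x y') (c x y) ×-dec
   (ℕ._≟_ ≠? c x y) (c x'' y) ×-dec (ℕ._≟_ ≠? c x'' y) (c x'' y''))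

absPath2? : ∀ {n} (c : Colouring n) x₁ y₁ x₂ y₂ (P : Quad n) → Dec (AbsPath2 c x₁ y₁ x₂ y₂ P)
absPath2? c x₁ y₁ x₂ y₂ P@(x' , y' , x'' , y'') =
  isPCPath3? c P ×-dec
  ((_≟ᶠ_ ≠? x') x₁ ×-dec (_≟ᶠ_ ≠? x'') x₁ ×-dec (_≟ᶠ_ ≠? x') x₂ ×-dec (_≟ᶠ_ ≠? x'') x₂ ×-dec
   (_≟ᶠ_ ≠? y') y₁ ×-dec (_≟ᶠ_ ≠? y'') y₁ ×-dec (_≟ᶠ_ ≠? y') y₂ ×-dec (_≟ᶠ_ ≠? y'') y₂) ×-dec
  ((ℕ._≟_ ≠? c x' y') (c x₁ y') ×-dec (ℕ._≟_ ≠? c x₁ y') (c x₁ y₁)) ×-dec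
  ((ℕ._≟_ ≠? c x'' y'') (c x'' y₂) ×-dec (ℕ._≟_ ≠? c x'' y₂) (c x₂ y₂))

numAbs : ∀ {n} → Colouring n → Fin n → Fin n → ℕ
numAbs {n} c x y = length (filter (absPath? c x y) (allQuads n))

numAbs2 : ∀ {n} → Colouring n → Fin n → Fin n → Fin n → Fin n → ℕ
numAbs2 {n} c x₁ y₁ x₂ y₂ = length (filter (absPath2? c x₁ y₁ x₂ y₂) (allQuads n))

toℚ : ℕ → ℚ
toℚ m = + m / 1

4/_[_] : (ε : ℚ) → 0ℚ < ε → ℚ
4/ ε [ h ] = (toℚ 4 ÷ ε) {{pos⇒nonZero ε {{positive h}}}}

{-# OPTIONS --safe #-}
-- Build an absorbing path vertex by vertex in the order y', x'', x', y''. Each new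
-- vertex only has to avoid at most three colours at an already chosen vertex (every
-- required distinctness of vertices follows from a distinctness of colours), so it has
-- at least δ^c − 3 ≥ 2n/3 choices, giving at least (2n/3)⁴ = (16/81) n⁴ absorbing
-- paths. Since δ^c ≤ n, the degree condition forces ε ≤ 1/3, and then
-- (16/81) n⁴ ≥ (16/9) ε² n⁴.
module Submission where

open import Defs
open import Data.Fin using (Fin)
open import Data.Product using (_×_; _,_; proj₁; proj₂; ∃-syntax)
open import Relation.Binary.PropositionalEquality
  using (_≡_; _≢_; refl; sym; trans; cong; cong₂; subst₂; ≢-sym; module ≡-Reasoning)

module ListCounting where

  open import Data.List using (List; []; _∷_; _++_; length; map; filter; concatMap; deduplicate)
  open import Data.List.Properties using (length-++; length-map; filter-++; filter-notAll; map-cong)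
  open import Data.List.Membership.Propositional.Properties
    using (∈-filter⁺; ∈-map⁺; ∈-map⁻; ∈-++⁺ˡ; ∈-++⁺ʳ; ∈-deduplicate⁻)
  open import Data.List.Relation.Binary.Subset.Propositional using (_⊆_)
  open import Data.List.Relation.Binary.Sublist.Propositional using (⊆-refl)
  open import Data.List.Relation.Binary.Sublist.Propositional.Properties using (filter⁺)
  open import Data.List.Relation.Binary.Sublist.Heterogeneous.Properties using (length-mono-≤)
  open import Data.List.Relation.Unary.All using (All; all?; lookup)
  open import Data.List.Relation.Unary.All.Properties using (¬Any⇒All¬)
  open import Data.List.Relation.Unary.Any as Any using (Any; here; there)
  open import Data.List.Relation.Unary.AllPairs using (_∷_)
  open import Data.List.Relation.Unary.Unique.Propositional using (Unique)
  open import Data.List.Relation.Unary.Unique.DecPropositional.Properties using (deduplicate-!)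
  open import Data.Nat using (ℕ; suc; _+_; _*_; _≤_; z≤n; s≤s; _≟_)
  open import Data.Nat.ListAction using (sum)
  open import Data.List.Membership.DecPropositional _≟_ using (_∈?_)
  open import Data.Nat.Properties
  open import Algebra.Properties.CommutativeSemigroup +-commutativeSemigroup using (interchange)
  open import Level using (0ℓ)
  open import Relation.Binary.Definitions using (DecidableEquality)
  open import Relation.Nullary using (¬_; yes; no)
  open import Relation.Nullary.Decidable using (¬?)
  open import Relation.Unary using (Pred; Decidable) renaming (_⊆_ to _⇒_)

  module _ {A : Set} where

    sum-map-cong : {f g : A → ℕ} (xs : List A) → (∀ a → f a ≡ g a) → sum (map f xs) ≡ sum (map g xs)
    sum-map-cong xs f≗g = cong sum (map-cong f≗g xs)

    sum-map-+ : (f g : A → ℕ) (xs : List A) →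
                sum (map (λ a → f a + g a) xs) ≡ sum (map f xs) + sum (map g xs)
    sum-map-+ f g []       = refl
    sum-map-+ f g (x ∷ xs) = begin
      f x + g x + sum (map (λ a → f a + g a) xs)      ≡⟨ cong (f x + g x +_) (sum-map-+ f g xs) ⟩
      f x + g x + (sum (map f xs) + sum (map g xs))   ≡⟨ interchange (f x) (g x) _ _ ⟩
      f x + sum (map f xs) + (g x + sum (map g xs))   ∎
      where open ≡-Reasoning

    sum-map-zero : (xs : List A) → sum (map (λ _ → 0) xs) ≡ 0
    sum-map-zero []       = refl
    sum-map-zero (_ ∷ xs) = sum-map-zero xs

    length-filter-mono : {P Q : Pred A 0ℓ} (P? : Decidable P) (Q? : Decidable Q) →
                         P ⇒ Q → (xs : List A) → length (filter P? xs) ≤ length (filter Q? xs)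
    length-filter-mono P? Q? P⇒Q xs = length-mono-≤ (filter⁺ P? Q? (λ { refl → P⇒Q }) (⊆-refl {x = xs}))

    *-≤-sum-map : {P : Pred A 0ℓ} (P? : Decidable P) {k m : ℕ} (f : A → ℕ) (xs : List A) →
                  k ≤ length (filter P? xs) → (∀ {a} → P a → m ≤ f a) → k * m ≤ sum (map f xs)
    *-≤-sum-map P? {m = m} f xs k≤#P m≤f = ≤-trans (*-monoˡ-≤ m k≤#P) (#P*m≤sum xs)
      where
      #P*m≤sum : (ys : List A) → length (filter P? ys) * m ≤ sum (map f ys)
      #P*m≤sum []       = z≤n
      #P*m≤sum (y ∷ ys) with P? y
      ... | yes py = +-mono-≤ (m≤f py) (#P*m≤sum ys)
      ... | no  _  = ≤-trans (#P*m≤sum ys) (m≤n+m _ (f y))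

  module _ {A B : Set} where

    sum-map-swap : (h : A → B → ℕ) (xs : List A) (ys : List B) →
                   sum (map (λ a → sum (map (h a) ys)) xs) ≡ sum (map (λ b → sum (map (λ a → h a b) xs)) ys)
    sum-map-swap h []       ys = sym (sum-map-zero ys)
    sum-map-swap h (x ∷ xs) ys = begin
      sum (map (h x) ys) + sum (map (λ a → sum (map (h a) ys)) xs)
        ≡⟨ cong (sum (map (h x) ys) +_) (sum-map-swap h xs ys) ⟩
      sum (map (h x) ys) + sum (map (λ b → sum (map (λ a → h a b) xs)) ys)
        ≡⟨ sum-map-+ (h x) (λ b → sum (map (λ a → h a b) xs)) ys ⟨
      sum (map (λ b → h x b + sum (map (λ a → h a b) xs)) ys) ∎
      where open ≡-Reasoning

    length-filter-concatMap : {P : Pred B 0ℓ} (P? : Decidable P) (f : A → List B) (xs : List A) →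
                              length (filter P? (concatMap f xs)) ≡ sum (map (λ a → length (filter P? (f a))) xs)
    length-filter-concatMap P? f []       = refl
    length-filter-concatMap P? f (x ∷ xs) = begin
      length (filter P? (f x ++ concatMap f xs))               ≡⟨ cong length (filter-++ P? (f x) _) ⟩
      length (filter P? (f x) ++ filter P? (concatMap f xs))   ≡⟨ length-++ (filter P? (f x)) ⟩
      length (filter P? (f x)) + length (filter P? (concatMap f xs))
        ≡⟨ cong (length (filter P? (f x)) +_) (length-filter-concatMap P? f xs) ⟩
      length (filter P? (f x)) + sum (map (λ a → length (filter P? (f a))) xs) ∎
      where open ≡-Reasoning

    length-filter-map : {P : Pred B 0ℓ} (P? : Decidable P) (h : A → B) (xs : List A) →
                        length (filter P? (map h xs)) ≡ length (filter (λ a → P? (h a)) xs)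
    length-filter-map P? h []       = refl
    length-filter-map P? h (x ∷ xs) with P? (h x)
    ... | yes _ = cong suc (length-filter-map P? h xs)
    ... | no  _ = length-filter-map P? h xs

  Unique-⊆⇒length-≤ : {A : Set} (_≟ᴬ_ : DecidableEquality A) {xs ys : List A} →
                      Unique xs → xs ⊆ ys → length xs ≤ length ys
  Unique-⊆⇒length-≤ _≟ᴬ_ {[]}     _            _     = z≤n
  Unique-⊆⇒length-≤ _≟ᴬ_ {x ∷ xs} {ys} (x∉xs ∷ !xs) xs⊆ys = begin
    suc (length xs)               ≤⟨ s≤s (Unique-⊆⇒length-≤ _≟ᴬ_ !xs xs⊆ys-x) ⟩
    suc (length (filter ≢x? ys))  ≤⟨ filter-notAll ≢x? ys x∈ys ⟩
    length ys                     ∎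
    where
    open ≤-Reasoning
    ≢x? : Decidable (x ≢_)
    ≢x? y = ¬? (x ≟ᴬ y)
    xs⊆ys-x : xs ⊆ filter ≢x? ys
    xs⊆ys-x z∈xs = ∈-filter⁺ ≢x? (xs⊆ys (there z∈xs)) (lookup x∉xs z∈xs)
    x∈ys : Any (λ y → ¬ ¬ x ≡ y) ys
    x∈ys = Any.map (λ x≡y x≢y → x≢y x≡y) (xs⊆ys (here refl))

  Avoiding : {A : Set} → (A → ℕ) → List ℕ → Pred A 0ℓ
  Avoiding g forbidden a = All (g a ≢_) forbidden

  avoiding? : {A : Set} (g : A → ℕ) (forbidden : List ℕ) → Decidable (Avoiding g forbidden)
  avoiding? g forbidden a = all? (λ b → ¬? (g a ≟ b)) forbidden

  #colours≤#forbidden+#avoiding : {A : Set} (g : A → ℕ) (forbidden : List ℕ) (xs : List A) →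
    length (deduplicate _≟_ (map g xs)) ≤ length forbidden + length (filter (avoiding? g forbidden) xs)
  #colours≤#forbidden+#avoiding g forbidden xs = begin
    length (deduplicate _≟_ (map g xs))        ≤⟨ Unique-⊆⇒length-≤ _≟_ (deduplicate-! _≟_ (map g xs)) colours⊆ ⟩
    length (forbidden ++ map g avoiders)        ≡⟨ length-++ forbidden ⟩
    length forbidden + length (map g avoiders)  ≡⟨ cong (length forbidden +_) (length-map g avoiders) ⟩
    length forbidden + length avoiders          ∎
    where
    open ≤-Reasoning
    avoiders : List _
    avoiders = filter (avoiding? g forbidden) xs
    colours⊆ : deduplicate _≟_ (map g xs) ⊆ forbidden ++ map g avoiders
    colours⊆ z∈ with ∈-map⁻ g (∈-deduplicate⁻ _≟_ (map g xs) z∈)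
    ... | a , a∈xs , refl with g a ∈? forbidden
    ...   | yes ga∈ = ∈-++⁺ˡ ga∈
    ...   | no  ga∉ = ∈-++⁺ʳ forbidden (∈-map⁺ g (∈-filter⁺ (avoiding? g forbidden) a∈xs (¬Any⇒All¬ forbidden ga∉)))

module AbsorbingPaths where

  open ListCounting
  open import Data.List using (List; []; _∷_; [_]; length; map; filter; deduplicate; allFin)
  open import Data.List.Properties using (length-map; length-tabulate; length-deduplicate)
  open import Data.List.Relation.Unary.All using (_∷_; [])
  open import Data.Nat using (ℕ; _+_; _*_; _^_; _≤_; z≤n; s≤s; _≟_)
  open import Data.Nat.ListAction using (sum)
  open import Data.Nat.Properties
  open import Function using (_∘_; flip; id)
  open import Level using (0ℓ)
  open import Relation.Unary using (Pred; Decidable)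

  module _ {n : ℕ} where

    private
      V : List (Fin n)
      V = allFin n

    length-filter-allQuads : {P : Pred (Quad n) 0ℓ} (P? : Decidable P) →
      length (filter P? (allQuads n))
        ≡ sum (map (λ y' → sum (map (λ x'' → sum (map (λ x' →
            length (filter (λ y'' → P? (x' , y' , x'' , y'')) V)) V)) V)) V)
    length-filter-allQuads P? = begin
      length (filter P? (allQuads n))
        ≡⟨ trans (length-filter-concatMap P? _ V) (sum-map-cong V λ x' →
           trans (length-filter-concatMap P? _ V) (sum-map-cong V λ y' →
           trans (length-filter-concatMap P? _ V) (sum-map-cong V λ x'' →
           length-filter-map P? _ V))) ⟩
      sum (map (λ x' → sum (map (λ y' → sum (map (count x' y') V)) V)) V)
        ≡⟨ sum-map-swap (λ x' y' → sum (map (count x' y') V)) V V ⟩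
      sum (map (λ y' → sum (map (λ x' → sum (map (count x' y') V)) V)) V)
        ≡⟨ sum-map-cong V (λ y' → sum-map-swap (λ x' → count x' y') V V) ⟩
      sum (map (λ y' → sum (map (λ x'' → sum (map (λ x' → count x' y' x'') V)) V)) V) ∎
      where
      open ≡-Reasoning
      count : Fin n → Fin n → Fin n → ℕ
      count x' y' x'' = length (filter (λ y'' → P? (x' , y' , x'' , y'')) V)

    length-filter-allQuads-≥ :
      {P : Pred (Quad n) 0ℓ} (P? : Decidable P) {k : ℕ}
      {Y' : Pred (Fin n) 0ℓ} {X'' : Fin n → Pred (Fin n) 0ℓ}
      {X' : Fin n → Fin n → Pred (Fin n) 0ℓ} {Y'' : Fin n → Fin n → Fin n → Pred (Fin n) 0ℓ}
      (Y'? : Decidable Y') (X''? : ∀ y' → Decidable (X'' y'))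
      (X'? : ∀ y' x'' → Decidable (X' y' x'')) (Y''? : ∀ y' x'' x' → Decidable (Y'' y' x'' x')) →
      k ≤ length (filter Y'? V) →
      (∀ {y'} → Y' y' → k ≤ length (filter (X''? y') V)) →
      (∀ {y' x''} → Y' y' → X'' y' x'' → k ≤ length (filter (X'? y' x'') V)) →
      (∀ {y' x'' x'} → Y' y' → X'' y' x'' → X' y' x'' x' → k ≤ length (filter (Y''? y' x'' x') V)) →
      (∀ {x' y' x'' y''} → Y' y' → X'' y' x'' → X' y' x'' x' → Y'' y' x'' x' y'' → P (x' , y' , x'' , y'')) →
      k ^ 4 ≤ length (filter P? (allQuads n))
    length-filter-allQuads-≥ P? {k} {Y'} {X''} {X'} Y'? X''? X'? Y''? #Y' #X'' #X' #Y'' stages⇒P = begin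
      k * (k * (k * (k * 1)))
        ≤⟨ *-≤-sum-map Y'? _ V #Y' (λ y'∈Y' →
           *-≤-sum-map (X''? _) _ V (#X'' y'∈Y') (λ x''∈X'' →
           *-≤-sum-map (X'? _ _) _ V (#X' y'∈Y' x''∈X'') (λ x'∈X' →
           last-stage y'∈Y' x''∈X'' x'∈X'))) ⟩
      sum (map (λ y' → sum (map (λ x'' → sum (map (λ x' →
          length (filter (λ y'' → P? (x' , y' , x'' , y'')) V)) V)) V)) V)
        ≡⟨ length-filter-allQuads P? ⟨
      length (filter P? (allQuads n)) ∎
      where
      open ≤-Reasoning
      last-stage : ∀ {y' x'' x'} → Y' y' → X'' y' x'' → X' y' x'' x' →
                   k * 1 ≤ length (filter (λ y'' → P? (x' , y' , x'' , y'')) V)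
      last-stage y'∈Y' x''∈X'' x'∈X' = begin
        k * 1                            ≡⟨ *-identityʳ k ⟩
        k                                ≤⟨ #Y'' y'∈Y' x''∈X'' x'∈X' ⟩
        length (filter (Y''? _ _ _) V)   ≤⟨ length-filter-mono (Y''? _ _ _) _ (stages⇒P y'∈Y' x''∈X'' x'∈X') V ⟩
        length (filter (λ y'' → P? (_ , _ , _ , y'')) V) ∎

  colDegX≤n : ∀ {n} (c : Colouring n) x → colDegX c x ≤ n
  colDegX≤n {n} c x = begin
    length (deduplicate _≟_ (map (c x) (allFin n)))   ≤⟨ length-deduplicate _≟_ (map (c x) (allFin n)) ⟩
    length (map (c x) (allFin n))                     ≡⟨ length-map (c x) (allFin n) ⟩
    length (allFin n)                                 ≡⟨ length-tabulate id ⟩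
    n                                                 ∎
    where open ≤-Reasoning

  module _ {n : ℕ} (c : Colouring n) where

    absPath-of-avoiding : ∀ {x y x' y' x'' y''} →
      Avoiding (c x) [ c x y ] y' →
      Avoiding (flip c y) [ c x y ] x'' →
      Avoiding (flip c y') (c x y' ∷ c x'' y' ∷ []) x' →
      Avoiding (c x'') (c x'' y ∷ c x'' y' ∷ []) y'' →
      AbsPath c x y (x' , y' , x'' , y'')
    absPath-of-avoiding {x} {y} {x'} {y'} {x''} {y''}
      (xy'≢xy ∷ []) (x''y≢xy ∷ []) (x'y'≢xy' ∷ x'y'≢x''y' ∷ []) (x''y''≢x''y ∷ x''y''≢x''y' ∷ []) =
        ( x'y'≢x''y' ∘ cong (flip c y') , ≢-sym (x''y''≢x''y' ∘ cong (c x''))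
        , x'y'≢x''y' , ≢-sym x''y''≢x''y' )
      , ( x'y'≢xy' ∘ cong (flip c y') , x''y≢xy ∘ cong (flip c y)
        , xy'≢xy ∘ cong (c x) , x''y''≢x''y ∘ cong (c x'') )
      , ( x'y'≢xy' , xy'≢xy , ≢-sym x''y≢xy , ≢-sym x''y''≢x''y )

    absPath2-of-avoiding : ∀ {x₁ y₁ x₂ y₂ x' y' x'' y''} →
      Avoiding (c x₁) (c x₁ y₁ ∷ c x₁ y₂ ∷ []) y' →
      Avoiding (flip c y₂) (c x₂ y₂ ∷ c x₁ y₂ ∷ []) x'' →
      Avoiding (flip c y') (c x₁ y' ∷ c x₂ y' ∷ c x'' y' ∷ []) x' →
      Avoiding (c x'') (c x'' y₁ ∷ c x'' y₂ ∷ c x'' y' ∷ []) y'' →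
      AbsPath2 c x₁ y₁ x₂ y₂ (x' , y' , x'' , y'')
    absPath2-of-avoiding {x₁} {y₁} {x₂} {y₂} {x'} {y'} {x''} {y''}
      (x₁y'≢x₁y₁ ∷ x₁y'≢x₁y₂ ∷ []) (x''y₂≢x₂y₂ ∷ x''y₂≢x₁y₂ ∷ [])
      (x'y'≢x₁y' ∷ x'y'≢x₂y' ∷ x'y'≢x''y' ∷ []) (x''y''≢x''y₁ ∷ x''y''≢x''y₂ ∷ x''y''≢x''y' ∷ []) =
        ( x'y'≢x''y' ∘ cong (flip c y') , ≢-sym (x''y''≢x''y' ∘ cong (c x''))
        , x'y'≢x''y' , ≢-sym x''y''≢x''y' )
      , ( x'y'≢x₁y' ∘ cong (flip c y') , x''y₂≢x₁y₂ ∘ cong (flip c y₂)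
        , x'y'≢x₂y' ∘ cong (flip c y') , x''y₂≢x₂y₂ ∘ cong (flip c y₂)
        , x₁y'≢x₁y₁ ∘ cong (c x₁) , x''y''≢x''y₁ ∘ cong (c x'')
        , x₁y'≢x₁y₂ ∘ cong (c x₁) , x''y''≢x''y₂ ∘ cong (c x'') )
      , ( x'y'≢x₁y' , x₁y'≢x₁y₁ )
      , ( x''y''≢x''y₂ , x''y₂≢x₂y₂ )

    module _ {k : ℕ} (degX : ∀ x → 3 + k ≤ colDegX c x) (degY : ∀ y → 3 + k ≤ colDegY c y) where

      private
        avoiding-choices : (g : Fin n → ℕ) {forbidden : List ℕ} → length forbidden ≤ 3 →
                           3 + k ≤ length (deduplicate _≟_ (map g (allFin n))) →
                           k ≤ length (filter (avoiding? g forbidden) (allFin n))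
        avoiding-choices g {forbidden} #forbidden≤3 3+k≤deg = +-cancelˡ-≤ (length forbidden) _ _
          (≤-trans (+-monoˡ-≤ k #forbidden≤3)
            (≤-trans 3+k≤deg (#colours≤#forbidden+#avoiding g forbidden (allFin n))))

        in-row : ∀ x {forbidden} → length forbidden ≤ 3 →
                 k ≤ length (filter (avoiding? (c x) forbidden) (allFin n))
        in-row x #forbidden≤3 = avoiding-choices (c x) #forbidden≤3 (degX x)

        in-column : ∀ y {forbidden} → length forbidden ≤ 3 →
                    k ≤ length (filter (avoiding? (flip c y) forbidden) (allFin n))
        in-column y #forbidden≤3 = avoiding-choices (flip c y) #forbidden≤3 (degY y)

        1≤3 : 1 ≤ 3
        1≤3 = s≤s z≤n

        2≤3 : 2 ≤ 3
        2≤3 = s≤s (s≤s z≤n)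

      numAbs-≥ : ∀ x y → k ^ 4 ≤ numAbs c x y
      numAbs-≥ x y = length-filter-allQuads-≥ (absPath? c x y)
        (avoiding? (c x) [ c x y ])
        (λ _ → avoiding? (flip c y) [ c x y ])
        (λ y' x'' → avoiding? (flip c y') (c x y' ∷ c x'' y' ∷ []))
        (λ y' x'' _ → avoiding? (c x'') (c x'' y ∷ c x'' y' ∷ []))
        (in-row x 1≤3) (λ _ → in-column y 1≤3) (λ {y'} _ _ → in-column y' 2≤3) (λ {_} {x''} _ _ _ → in-row x'' 2≤3)
        absPath-of-avoiding

      numAbs2-≥ : ∀ x₁ y₁ x₂ y₂ → k ^ 4 ≤ numAbs2 c x₁ y₁ x₂ y₂
      numAbs2-≥ x₁ y₁ x₂ y₂ = length-filter-allQuads-≥ (absPath2? c x₁ y₁ x₂ y₂)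
        (avoiding? (c x₁) (c x₁ y₁ ∷ c x₁ y₂ ∷ []))
        (λ _ → avoiding? (flip c y₂) (c x₂ y₂ ∷ c x₁ y₂ ∷ []))
        (λ y' x'' → avoiding? (flip c y') (c x₁ y' ∷ c x₂ y' ∷ c x'' y' ∷ []))
        (λ y' x'' _ → avoiding? (c x'') (c x'' y₁ ∷ c x'' y₂ ∷ c x'' y' ∷ []))
        (in-row x₁ 2≤3) (λ _ → in-column y₂ 2≤3) (λ {y'} _ _ → in-column y' ≤-refl) (λ {_} {x''} _ _ _ → in-row x'' ≤-refl)
        absPath2-of-avoiding

module NatBounds where

  open import Data.Nat using (zero; suc; _+_; _*_; _^_; _≤_; z≤n; _≟_)
  open import Data.Nat.Properties
  open import Data.Nat.Tactic.RingSolver using (solve-∀)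
  open import Relation.Nullary using (yes; no)

  round-up-to-multiple-of-3 : ∀ m → ∃[ k ] m ≤ 3 * k × 3 * k ≤ 2 + m
  round-up-to-multiple-of-3 zero = 0 , z≤n , z≤n
  round-up-to-multiple-of-3 (suc m) with round-up-to-multiple-of-3 m
  ... | k , m≤3k , 3k≤2+m with m ≟ 3 * k
  ...   | no  m≢3k = k , ≤∧≢⇒< m≤3k m≢3k , m≤n⇒m≤1+n 3k≤2+m
  ...   | yes m≡3k = suc k , ≤-trans (m≤n+m (suc m) 2) (≤-reflexive (sym 3[1+k]≡3+m)) , ≤-reflexive 3[1+k]≡3+m
    where
    3[1+k]≡3+m : 3 * suc k ≡ 3 + m
    3[1+k]≡3+m = trans (*-suc 3 k) (cong (3 +_) (sym m≡3k))

  3+k≤d : ∀ {m k d} → 3 * k ≤ 2 + m → m + 12 ≤ 3 * d → 3 + k ≤ d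
  3+k≤d {m} {k} {d} 3k≤2+m m+12≤3d = *-cancelˡ-≤ 3 (begin
    3 * (3 + k)   ≡⟨ *-distribˡ-+ 3 3 k ⟩
    9 + 3 * k     ≤⟨ +-monoʳ-≤ 9 3k≤2+m ⟩
    11 + m        ≤⟨ n≤1+n _ ⟩
    12 + m        ≡⟨ +-comm 12 m ⟩
    m + 12        ≤⟨ m+12≤3d ⟩
    3 * d         ∎)
    where open ≤-Reasoning

  16n⁴≤81k⁴ : ∀ {n k} → 2 * n ≤ 3 * k → 16 * n ^ 4 ≤ 81 * k ^ 4
  16n⁴≤81k⁴ {n} {k} 2n≤3k = begin
    16 * n ^ 4    ≡⟨ [2m]⁴≡16m⁴ n ⟨
    (2 * n) ^ 4   ≤⟨ ^-monoˡ-≤ 4 2n≤3k ⟩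
    (3 * k) ^ 4   ≡⟨ [3m]⁴≡81m⁴ k ⟩
    81 * k ^ 4    ∎
    where
    open ≤-Reasoning
    -- stated with _^_ unfolded, the form the ring solver accepts
    [2m]⁴≡16m⁴ : ∀ m → let 2m = 2 * m in 2m * (2m * (2m * (2m * 1))) ≡ 16 * (m * (m * (m * (m * 1))))
    [2m]⁴≡16m⁴ = solve-∀
    [3m]⁴≡81m⁴ : ∀ m → let 3m = 3 * m in 3m * (3m * (3m * (3m * 1))) ≡ 81 * (m * (m * (m * (m * 1))))
    [3m]⁴≡81m⁴ = solve-∀

open AbsorbingPaths
open NatBounds
open import Data.Fin.Properties using (nonZeroIndex)
open import Data.Integer as ℤ using (+_)
import Data.Integer.Properties as ℤ
open import Data.Nat as ℕ using (ℕ; _^_)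
import Data.Nat.Coprimality as Coprime
import Data.Nat.Properties as ℕ
open import Data.Rational
  using (ℚ; mkℚ; 0ℚ; 1ℚ; _<_; _≤_; _+_; _*_; _/_; -_; 1/_; *≤*; NonZero; NonNegative; Positive; positive; nonNegative)
open import Data.Rational.Properties
open import Data.Rational.Solver using (module +-*-Solver)

toℚ≡mkℚ : ∀ m → toℚ m ≡ mkℚ (+ m) 0 (Coprime.sym (Coprime.1-coprimeTo m))
toℚ≡mkℚ m = normalize-coprime _

toℚ-homo-+ : ∀ a b → toℚ (a ℕ.+ b) ≡ toℚ a + toℚ b
toℚ-homo-+ a b = begin
  + (a ℕ.+ b) / 1                       ≡⟨ cong₂ (λ i j → (i ℤ.+ j) / 1) (ℤ.*-identityʳ (+ a)) (ℤ.*-identityʳ (+ b)) ⟨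
  (+ a ℤ.* + 1 ℤ.+ + b ℤ.* + 1) / 1     ≡⟨ cong₂ _+_ (toℚ≡mkℚ a) (toℚ≡mkℚ b) ⟨
  toℚ a + toℚ b                         ∎
  where open ≡-Reasoning

toℚ-homo-* : ∀ a b → toℚ (a ℕ.* b) ≡ toℚ a * toℚ b
toℚ-homo-* a b = begin
  + (a ℕ.* b) / 1     ≡⟨ cong (_/ 1) (ℤ.pos-* a b) ⟩
  (+ a ℤ.* + b) / 1   ≡⟨ cong₂ _*_ (toℚ≡mkℚ a) (toℚ≡mkℚ b) ⟨
  toℚ a * toℚ b       ∎
  where open ≡-Reasoning

toℚ-mono-≤ : ∀ {a b} → a ℕ.≤ b → toℚ a ≤ toℚ b
toℚ-mono-≤ {a} {b} a≤b = subst₂ _≤_ (sym (toℚ≡mkℚ a)) (sym (toℚ≡mkℚ b))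
  (*≤* (subst₂ ℤ._≤_ (sym (ℤ.*-identityʳ (+ a))) (sym (ℤ.*-identityʳ (+ b))) (ℤ.+≤+ a≤b)))

toℚ-cancel-≤ : ∀ {a b} → toℚ a ≤ toℚ b → a ℕ.≤ b
toℚ-cancel-≤ {a} {b} toℚa≤toℚb with subst₂ _≤_ (toℚ≡mkℚ a) (toℚ≡mkℚ b) toℚa≤toℚb
... | *≤* a*1≤b*1 = ℤ.drop‿+≤+ (subst₂ ℤ._≤_ (ℤ.*-identityʳ (+ a)) (ℤ.*-identityʳ (+ b)) a*1≤b*1)

module _ (ε : ℚ) where

  open +-*-Solver

  εn≥4 : (ε>0 : 0ℚ < ε) {n : ℕ} → 4/ ε [ ε>0 ] ≤ toℚ n → toℚ 4 ≤ ε * toℚ n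
  εn≥4 ε>0 {n} n≥4/ε = begin
    toℚ 4                ≡⟨ *-identityˡ (toℚ 4) ⟨
    1ℚ * toℚ 4           ≡⟨ cong (_* toℚ 4) (*-inverseʳ ε) ⟨
    ε * 1/ ε * toℚ 4     ≡⟨ *-assoc ε (1/ ε) (toℚ 4) ⟩
    ε * (1/ ε * toℚ 4)   ≡⟨ cong (ε *_) (*-comm (1/ ε) (toℚ 4)) ⟩
    ε * 4/ ε [ ε>0 ]     ≤⟨ *-monoˡ-≤-nonNeg ε n≥4/ε ⟩
    ε * toℚ n            ∎
    where
    open ≤-Reasoning
    instance
      ε-positive : Positive ε
      ε-positive = positive ε>0
      ε-nonZero : NonZero ε
      ε-nonZero = pos⇒nonZero ε
      ε-nonNeg : NonNegative ε
      ε-nonNeg = pos⇒nonNeg ε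

  2n+12≤3d : ∀ {n d} → toℚ 4 ≤ ε * toℚ n → ((+ 2 / 3) + ε) * toℚ n ≤ toℚ d → 2 ℕ.* n ℕ.+ 12 ℕ.≤ 3 ℕ.* d
  2n+12≤3d {n} {d} εn≥4 large = toℚ-cancel-≤ (begin
    toℚ (2 ℕ.* n ℕ.+ 12)                      ≡⟨ trans (toℚ-homo-+ (2 ℕ.* n) 12) (cong (_+ toℚ 12) (toℚ-homo-* 2 n)) ⟩
    toℚ 2 * toℚ n + toℚ 12                    ≡⟨ solve 1 (λ N → con (toℚ 2) :* N :+ con (toℚ 12)
                                                    := con (toℚ 3) :* (con (+ 2 / 3) :* N :+ con (toℚ 4))) refl (toℚ n) ⟩
    toℚ 3 * ((+ 2 / 3) * toℚ n + toℚ 4)       ≤⟨ *-monoˡ-≤-nonNeg (toℚ 3) (+-monoʳ-≤ ((+ 2 / 3) * toℚ n) εn≥4) ⟩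
    toℚ 3 * ((+ 2 / 3) * toℚ n + ε * toℚ n)   ≡⟨ cong (toℚ 3 *_) (*-distribʳ-+ (toℚ n) (+ 2 / 3) ε) ⟨
    toℚ 3 * (((+ 2 / 3) + ε) * toℚ n)         ≤⟨ *-monoˡ-≤-nonNeg (toℚ 3) large ⟩
    toℚ 3 * toℚ d                             ≡⟨ toℚ-homo-* 3 d ⟨
    toℚ (3 ℕ.* d)                             ∎)
    where open ≤-Reasoning

  ε≤⅓ : ∀ {n d} .{{_ : ℕ.NonZero n}} → d ℕ.≤ n → ((+ 2 / 3) + ε) * toℚ n ≤ toℚ d → ε ≤ + 1 / 3
  ε≤⅓ {n} d≤n large = begin
    ε                              ≡⟨ solve 1 (λ e → e := con (+ 2 / 3) :+ e :+ :- con (+ 2 / 3)) refl ε ⟩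
    (+ 2 / 3) + ε + - (+ 2 / 3)    ≤⟨ +-monoˡ-≤ (- (+ 2 / 3)) ⅔+ε≤1 ⟩
    1ℚ + - (+ 2 / 3)               ≡⟨⟩
    + 1 / 3                        ∎
    where
    open ≤-Reasoning
    ⅔+ε≤1 : (+ 2 / 3) + ε ≤ 1ℚ
    ⅔+ε≤1 = *-cancelʳ-≤-pos (toℚ n) {{normalize-pos n 1}}
      (≤-trans large (≤-trans (toℚ-mono-≤ d≤n) (≤-reflexive (sym (*-identityˡ (toℚ n))))))

  16/9·ε²·a≤m : ∀ {a m} → 0ℚ ≤ ε → ε ≤ + 1 / 3 → 16 ℕ.* a ℕ.≤ 81 ℕ.* m → (+ 16 / 9) * (ε * ε) * toℚ a ≤ toℚ m
  16/9·ε²·a≤m {a} {m} ε≥0 ε≤⅓ 16a≤81m = *-cancelˡ-≤-pos (toℚ 81) (begin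
    toℚ 81 * ((+ 16 / 9) * (ε * ε) * toℚ a)     ≤⟨ *-monoˡ-≤-nonNeg (toℚ 81)
                                                     (*-monoʳ-≤-nonNeg (toℚ a) {{normalize-nonNeg a 1}}
                                                       (*-monoˡ-≤-nonNeg (+ 16 / 9) ε²≤1/9)) ⟩
    toℚ 81 * ((+ 16 / 9) * (+ 1 / 9) * toℚ a)   ≡⟨ *-assoc (toℚ 81) ((+ 16 / 9) * (+ 1 / 9)) (toℚ a) ⟨
    toℚ 16 * toℚ a                              ≡⟨ toℚ-homo-* 16 a ⟨
    toℚ (16 ℕ.* a)                              ≤⟨ toℚ-mono-≤ 16a≤81m ⟩
    toℚ (81 ℕ.* m)                              ≡⟨ toℚ-homo-* 81 m ⟩
    toℚ 81 * toℚ m                              ∎)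
    where
    open ≤-Reasoning
    instance
      ε-nonNeg : NonNegative ε
      ε-nonNeg = nonNegative ε≥0
    ε²≤1/9 : ε * ε ≤ + 1 / 9
    ε²≤1/9 = ≤-trans (*-monoˡ-≤-nonNeg ε ε≤⅓) (*-monoʳ-≤-nonNeg (+ 1 / 3) ε≤⅓)

lemma3p4 : (ε : ℚ) (ε>0 : 0ℚ < ε) (n : ℕ) (c : Colouring n)
    → MinColDegAtLeast c (λ d → ((+ 2 / 3) + ε) * toℚ n ≤ toℚ d)
    → 4/ ε [ ε>0 ] ≤ toℚ n
    → ((x y : Fin n) → ((+ 16 / 9) * (ε * ε)) * toℚ (n ^ 4) ≤ toℚ (numAbs c x y))
      × ((x₁ x₂ y₁ y₂ : Fin n) → x₁ ≢ x₂ → y₁ ≢ y₂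
         → ((+ 16 / 9) * (ε * ε)) * toℚ (n ^ 4) ≤ toℚ (numAbs2 c x₁ y₁ x₂ y₂))
lemma3p4 ε ε>0 n c (largeX , largeY) n≥4/ε =
    (λ x y → bound x (numAbs-≥ c degX degY x y))
  , (λ x₁ x₂ y₁ y₂ _ _ → bound x₁ (numAbs2-≥ c degX degY x₁ y₁ x₂ y₂))
  where
  k : ℕ
  k = proj₁ (round-up-to-multiple-of-3 (2 ℕ.* n))

  2n≤3k : 2 ℕ.* n ℕ.≤ 3 ℕ.* k
  2n≤3k = proj₁ (proj₂ (round-up-to-multiple-of-3 (2 ℕ.* n)))

  3k≤2+2n : 3 ℕ.* k ℕ.≤ 2 ℕ.+ 2 ℕ.* n
  3k≤2+2n = proj₂ (proj₂ (round-up-to-multiple-of-3 (2 ℕ.* n)))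

  3+k≤ : ∀ {d} → ((+ 2 / 3) + ε) * toℚ n ≤ toℚ d → 3 ℕ.+ k ℕ.≤ d
  3+k≤ {d} large = 3+k≤d {2 ℕ.* n} 3k≤2+2n (2n+12≤3d ε {n} {d} (εn≥4 ε ε>0 {n} n≥4/ε) large)

  degX : ∀ x → 3 ℕ.+ k ℕ.≤ colDegX c x
  degX x = 3+k≤ (largeX x)

  degY : ∀ y → 3 ℕ.+ k ℕ.≤ colDegY c y
  degY y = 3+k≤ (largeY y)

  bound : ∀ {m} → Fin n → k ^ 4 ℕ.≤ m → (+ 16 / 9) * (ε * ε) * toℚ (n ^ 4) ≤ toℚ m
  bound {m} x k⁴≤m = 16/9·ε²·a≤m ε {n ^ 4} {m} (<⇒≤ ε>0) (ε≤⅓ ε {n} {{nonZeroIndex x}} (colDegX≤n c x) (largeX x))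
    (ℕ.≤-trans (16n⁴≤81k⁴ {n} {k} 2n≤3k) (ℕ.*-monoʳ-≤ 81 k⁴≤m))
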